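{- Every graph $G$ of order $n$ with $\kappa_3(G)=2$ has at least $\frac{6}{5}n$ edges.
   Context: All graphs are finite and simple. For a nontrivial connected graph $G$ of order $n$ and an integer $k$ with $2\le k\le n$, and a set $S$ of $k$ vertices of $G$, $\kappa(S)$ denotes the maximum number $\ell$ of edge-disjoint trees $T_1,\dots,T_\ell$ in $G$ such that $V(T_i)\cap V(T_j)=S$ for every pair of distinct $i,j$. The $k$-connectivity of $G$ is $\kappa_k(G)=\min\{\kappa(S)\}$, the minimum taken over all $k$-subsets $S$ of $V(G)$. -}

module Defs where

open import Data.Nat using (ℕ; zero; suc; _+_; _*_; _≤_; _<ᵇ_)
open import Data.Bool using (Bool; true; false; _∧_; if_then_else_)
open import Data.Fin using (Fin; zero; suc; toℕ; inject₁; fromℕ)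
open import Data.Fin.Subset using (Subset; _∈_; ∣_∣)
open import Data.List using (List; map)
open import Data.Nat.ListAction using (sum)
open import Data.List using () renaming (allFin to allFinL)
open import Data.Product using (Σ; ∃; _×_; _,_)
open import Relation.Binary.PropositionalEquality using (_≡_; _≢_)
open import Relation.Nullary using (¬_)
open import Function.Definitions using (Injective)

record Graph (n : ℕ) : Set where
  field
    adj     : Fin n → Fin n → Bool
    sym     : ∀ u v → adj u v ≡ adj v u
    irrefl  : ∀ u → adj u u ≡ false
open Graph public

data Walk {n : ℕ} (E : Fin n → Fin n → Bool) : Fin n → Fin n → Set where
  here : ∀ {u} → Walk E u u
  step : ∀ {u w v} → E u w ≡ true → Walk E w v → Walk E u v

Cycle : {n : ℕ} → (Fin n → Fin n → Bool) → Set
Cycle {n} E = Σ ℕ λ m → Σ (Fin (3 + m) → Fin n) λ f →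
  Injective _≡_ _≡_ f ×
  (∀ (i : Fin (2 + m)) → E (f (inject₁ i)) (f (suc i)) ≡ true) ×
  E (f (fromℕ (2 + m))) (f zero) ≡ true

Connected : {n : ℕ} → Graph n → Set
Connected {n} G = ∀ (u v : Fin n) → Walk (adj G) u v

record STree {n : ℕ} (G : Graph n) (S : Subset n) : Set where
  field
    V        : Subset n
    E        : Fin n → Fin n → Bool
    E-sym    : ∀ u v → E u v ≡ E v u
    E-sub    : ∀ u v → E u v ≡ true → adj G u v ≡ true
    E-ends   : ∀ u v → E u v ≡ true → u ∈ V
    S⊆V      : ∀ x → x ∈ S → x ∈ V
    conn     : ∀ u v → u ∈ V → v ∈ V → Walk E u v
    acyclic  : ¬ Cycle E
open STree public

HasTrees : {n : ℕ} → Graph n → Subset n → ℕ → Set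
HasTrees {n} G S ℓ = Σ (Fin ℓ → STree G S) λ T →
  ∀ (i j : Fin ℓ) → i ≢ j →
    (∀ u v → E (T i) u v ≡ true → E (T j) u v ≡ false) ×
    (∀ x → x ∈ V (T i) → x ∈ V (T j) → x ∈ S)

KappaS : {n : ℕ} → Graph n → Subset n → ℕ → Set
KappaS G S m = HasTrees G S m × (∀ ℓ → HasTrees G S ℓ → ℓ ≤ m)

Kappa : {n : ℕ} → Graph n → ℕ → ℕ → Set
Kappa {n} G k m =
  (∀ (S : Subset n) → ∣ S ∣ ≡ k → Σ ℕ λ m′ → KappaS G S m′ × m ≤ m′) ×
  (Σ (Subset n) λ S → ∣ S ∣ ≡ k × KappaS G S m)

edgeCount : {n : ℕ} → Graph n → ℕ
edgeCount {n} G = sum (map (λ u → sum (map (λ v →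
  if (toℕ u <ᵇ toℕ v) ∧ adj G u v then 1 else 0) (allFinL n))) (allFinL n))

module Submission where

-- κ₃(G) = 2 gives two edge-disjoint S-trees for every 3-set S, and each
-- S-tree has an edge at every vertex of S and an edge leaving any part of
-- S.  Hence (1) every vertex has degree ≥ 2 (the two trees use different
-- edges at it), and (2) no edge uv has N(u) ⊆ {v, a} and N(v) ⊆ {u, b}:
-- with S = {u, v, x} each tree would contain two of uv, ua, vb (it covers
-- that "triangle"), and two disjoint trees would need four.  So vertices
-- of degree 2 are independent.  A discharging argument finishes: each
-- edge carries charge 10, split 6/4 towards an endpoint of degree 2 and
-- 5/5 otherwise; every vertex then receives ≥ 12, so 12n ≤ 10·|E(G)|.

open import Defs hiding (sym)
open import Data.Nat.Base using (ℕ; zero; suc; _+_; _*_; _∸_; _≤_; _<_; z≤n; s≤s; _≡ᵇ_; _<ᵇ_)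
open import Data.Nat.Properties as ℕ using (≤-trans; ≤-reflexive; +-mono-≤)
open import Data.Bool.Base using (Bool; true; false; _∧_; if_then_else_; T)
open import Data.Bool.Properties using (not-¬)
open import Data.Fin.Base using (Fin; zero; suc; toℕ)
open import Data.Fin.Properties using (toℕ-injective; _≟_)
open import Data.Fin.Subset using (Subset; _∈_; _∉_; ∣_∣; _∪_; _-_; ⁅_⁆; ∁; inside; outside)
open import Data.Fin.Subset.Properties
  using (x∈p⇒∣p-x∣<∣p∣; x∈p∧x≢y⇒x∈p-y; ∣p∣≤∣x∷p∣; x∈⁅x⁆; x∉⁅y⁆⇒x≢y; ∣⁅x⁆∣≡1;
         x∈p∪q⁺; x∈∁p⇒x∉p; ∣∁p∣≡n∸∣p∣; nonempty?; Empty-unique; ∣⊥∣≡0)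
open import Data.Vec.Base using ([]; _∷_; tabulate)
open import Data.Vec.Properties using (lookup∘tabulate; lookup⇒[]=)
open import Data.List.Base using (map) renaming (allFin to allFinᴸ; tabulate to tabulateᴸ)
open import Data.List.Properties using (map-tabulate)
open import Data.Nat.ListAction using () renaming (sum to sumᴸ)
open import Data.Product using (∃; ∃₂; _×_; _,_; proj₁; proj₂)
open import Data.Sum using (_⊎_; inj₁; inj₂; [_,_])
open import Data.Empty using (⊥; ⊥-elim)
open import Function.Base using (_∘_; id)
open import Relation.Binary.PropositionalEquality
  using (_≡_; _≢_; refl; sym; trans; cong; subst; subst₂; module ≡-Reasoning)
open import Relation.Nullary using (¬_; yes; no)
open import Relation.Nullary.Reflects using (ofʸ; ofⁿ)
open import Relation.Nullary.Decidable using (_⊎-dec_)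
open import Relation.Unary using (Decidable)
open import Algebra.Properties.CommutativeMonoid.Sum ℕ.+-0-commutativeMonoid
  using (sum; sum-syntax; sum-cong-≗; ∑-distrib-+; ∑-comm)
open import Algebra.Properties.Semiring.Sum ℕ.+-*-semiring using (*-distribˡ-sum)

∑-const : ∀ n k → ∑[ i < n ] k ≡ k * n
∑-const zero    k = sym (ℕ.*-zeroʳ k)
∑-const (suc n) k = trans (cong (k +_) (∑-const n k)) (sym (ℕ.*-suc k n))

∑-mono-≤ : ∀ {n} {f g : Fin n → ℕ} → (∀ i → f i ≤ g i) → sum f ≤ sum g
∑-mono-≤ {zero}  f≤g = z≤n
∑-mono-≤ {suc n} f≤g = +-mono-≤ (f≤g zero) (∑-mono-≤ (f≤g ∘ suc))

sumᴸ-allFin : ∀ n (f : Fin n → ℕ) → sumᴸ (map f (allFinᴸ n)) ≡ sum f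
sumᴸ-allFin n f = trans (cong sumᴸ (map-tabulate id f)) (sumᴸ-tabulate n f)
  where
  sumᴸ-tabulate : ∀ n (f : Fin n → ℕ) → sumᴸ (tabulateᴸ f) ≡ sum f
  sumᴸ-tabulate zero    f = refl
  sumᴸ-tabulate (suc n) f = cong (f zero +_) (sumᴸ-tabulate n (f ∘ suc))

_<ꟳ_ : ∀ {n} → Fin n → Fin n → Bool
u <ꟳ v = toℕ u <ᵇ toℕ v

∑∑-unordered : ∀ n (f : Fin n → Fin n → ℕ) → (∀ u → f u u ≡ 0) →
  ∑[ u < n ] ∑[ v < n ] f u v ≡
  ∑[ u < n ] ∑[ v < n ] (if u <ꟳ v then f u v + f v u else 0)
∑∑-unordered n f diag = begin
  ∑[ u < n ] ∑[ v < n ] f u v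
    ≡⟨ sum-cong-≗ (λ u → sum-cong-≗ (split u)) ⟩
  ∑[ u < n ] ∑[ v < n ] (below u v + above u v)
    ≡⟨ sum-cong-≗ (λ u → ∑-distrib-+ (below u) (above u)) ⟩
  ∑[ u < n ] (∑[ v < n ] below u v + ∑[ v < n ] above u v)
    ≡⟨ ∑-distrib-+ (λ u → ∑[ v < n ] below u v) (λ u → ∑[ v < n ] above u v) ⟩
  ∑[ u < n ] ∑[ v < n ] below u v + ∑[ u < n ] ∑[ v < n ] above u v
    ≡⟨ cong (∑[ u < n ] ∑[ v < n ] below u v +_) (∑-comm above) ⟩
  ∑[ u < n ] ∑[ v < n ] below u v + ∑[ u < n ] ∑[ v < n ] above v u
    ≡⟨ sym (∑-distrib-+ (λ u → ∑[ v < n ] below u v) (λ u → ∑[ v < n ] above v u)) ⟩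
  ∑[ u < n ] (∑[ v < n ] below u v + ∑[ v < n ] above v u)
    ≡⟨ sum-cong-≗ (λ u → sym (∑-distrib-+ (below u) (λ v → above v u))) ⟩
  ∑[ u < n ] ∑[ v < n ] (below u v + above v u)
    ≡⟨ sum-cong-≗ (λ u → sum-cong-≗ (merge u)) ⟩
  ∑[ u < n ] ∑[ v < n ] (if u <ꟳ v then f u v + f v u else 0)
    ∎
  where
  open ≡-Reasoning
  below above : Fin n → Fin n → ℕ
  below u v = if u <ꟳ v then f u v else 0
  above u v = if v <ꟳ u then f u v else 0

  split : ∀ u v → f u v ≡ below u v + above u v
  split u v with u <ꟳ v | ℕ.<ᵇ-reflects-< (toℕ u) (toℕ v)
             | v <ꟳ u | ℕ.<ᵇ-reflects-< (toℕ v) (toℕ u)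
  ... | true  | ofʸ u<v | true  | ofʸ v<u = ⊥-elim (ℕ.<-asym u<v v<u)
  ... | true  | _       | false | _       = sym (ℕ.+-identityʳ _)
  ... | false | _       | true  | _       = refl
  ... | false | ofⁿ u≮v | false | ofⁿ v≮u
    with refl ← toℕ-injective (ℕ.≤-antisym (ℕ.≮⇒≥ v≮u) (ℕ.≮⇒≥ u≮v)) = diag u

  merge : ∀ u v → below u v + above v u ≡ (if u <ꟳ v then f u v + f v u else 0)
  merge u v with u <ꟳ v
  ... | true  = refl
  ... | false = refl

size-after-removal : ∀ {n} {p : Subset n} {x k} → x ∈ p → k ≤ ∣ p - x ∣ → suc k ≤ ∣ p ∣
size-after-removal x∈p k≤ = ≤-trans (s≤s k≤) (x∈p⇒∣p-x∣<∣p∣ x∈p)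

two-members : ∀ {n} {p : Subset n} {x y} → x ∈ p → y ∈ p → y ≢ x → 2 ≤ ∣ p ∣
two-members x∈p y∈p y≢x =
  size-after-removal x∈p (size-after-removal (x∈p∧x≢y⇒x∈p-y y∈p y≢x) z≤n)

three-members : ∀ {n} {p : Subset n} {x y z} → x ∈ p → y ∈ p → z ∈ p →
  y ≢ x → z ≢ x → z ≢ y → 3 ≤ ∣ p ∣
three-members x∈p y∈p z∈p y≢x z≢x z≢y =
  size-after-removal x∈p (size-after-removal (x∈p∧x≢y⇒x∈p-y y∈p y≢x)
    (size-after-removal (x∈p∧x≢y⇒x∈p-y (x∈p∧x≢y⇒x∈p-y z∈p z≢x) z≢y) z≤n))

∣p∪q∣≤∣p∣+∣q∣ : ∀ {n} (p q : Subset n) → ∣ p ∪ q ∣ ≤ ∣ p ∣ + ∣ q ∣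
∣p∪q∣≤∣p∣+∣q∣ []            []            = z≤n
∣p∪q∣≤∣p∣+∣q∣ (outside ∷ p) (outside ∷ q) = ∣p∪q∣≤∣p∣+∣q∣ p q
∣p∪q∣≤∣p∣+∣q∣ (inside  ∷ p) (outside ∷ q) = s≤s (∣p∪q∣≤∣p∣+∣q∣ p q)
∣p∪q∣≤∣p∣+∣q∣ (outside ∷ p) (inside  ∷ q) =
  subst (suc ∣ p ∪ q ∣ ≤_) (sym (ℕ.+-suc ∣ p ∣ ∣ q ∣)) (s≤s (∣p∪q∣≤∣p∣+∣q∣ p q))
∣p∪q∣≤∣p∣+∣q∣ (inside  ∷ p) (inside  ∷ q) =
  s≤s (≤-trans (∣p∪q∣≤∣p∣+∣q∣ p q) (ℕ.+-monoʳ-≤ ∣ p ∣ (∣p∣≤∣x∷p∣ inside q)))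

triple : ∀ {n} → Fin n → Fin n → Fin n → Subset n
triple a b c = ⁅ a ⁆ ∪ ⁅ b ⁆ ∪ ⁅ c ⁆

module _ {n} (a b c : Fin n) where

  first∈triple : a ∈ triple a b c
  first∈triple = x∈p∪q⁺ (inj₁ (x∈⁅x⁆ a))

  second∈triple : b ∈ triple a b c
  second∈triple = x∈p∪q⁺ (inj₂ (x∈p∪q⁺ (inj₁ (x∈⁅x⁆ b))))

  third∈triple : c ∈ triple a b c
  third∈triple = x∈p∪q⁺ (inj₂ (x∈p∪q⁺ (inj₂ (x∈⁅x⁆ c))))

  ∣triple∣≡3 : b ≢ a → c ≢ a → c ≢ b → ∣ triple a b c ∣ ≡ 3
  ∣triple∣≡3 b≢a c≢a c≢b = ℕ.≤-antisym at-most-three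
    (three-members first∈triple second∈triple third∈triple b≢a c≢a c≢b)
    where
    singleton≤1 : ∀ x → ∣ ⁅ x ⁆ ∣ ≤ 1
    singleton≤1 x = ≤-reflexive (∣⁅x⁆∣≡1 x)
    at-most-three : ∣ triple a b c ∣ ≤ 3
    at-most-three = ≤-trans (∣p∪q∣≤∣p∣+∣q∣ ⁅ a ⁆ _) (+-mono-≤ (singleton≤1 a)
      (≤-trans (∣p∪q∣≤∣p∣+∣q∣ ⁅ b ⁆ ⁅ c ⁆) (+-mono-≤ (singleton≤1 b) (singleton≤1 c))))

non-member : ∀ {n} (p : Subset n) → ∣ p ∣ < n → ∃ λ x → x ∉ p
non-member {n} p ∣p∣<n with nonempty? (∁ p)
... | yes (x , x∈∁p) = x , x∈∁p⇒x∉p x∈∁p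
... | no ∁p-empty = ⊥-elim (ℕ.<-irrefl refl (subst (0 <_) ∣∁p∣≡0 (ℕ.m<n⇒0<n∸m ∣p∣<n)))
  where
  ∣∁p∣≡0 : n ∸ ∣ p ∣ ≡ 0
  ∣∁p∣≡0 = trans (sym (∣∁p∣≡n∸∣p∣ p)) (trans (cong ∣_∣ (Empty-unique ∁p-empty)) (∣⊥∣≡0 n))

third-vertex : ∀ {n} → 3 ≤ n → (u v : Fin n) → ∃ λ x → x ≢ u × x ≢ v
third-vertex n≥3 u v with non-member (⁅ u ⁆ ∪ ⁅ v ⁆) (≤-trans (s≤s size≤2) n≥3)
  where
  size≤2 : ∣ ⁅ u ⁆ ∪ ⁅ v ⁆ ∣ ≤ 2
  size≤2 = ≤-trans (∣p∪q∣≤∣p∣+∣q∣ ⁅ u ⁆ ⁅ v ⁆)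
    (+-mono-≤ (≤-reflexive (∣⁅x⁆∣≡1 u)) (≤-reflexive (∣⁅x⁆∣≡1 v)))
... | x , x∉ = x , x∉⁅y⁆⇒x≢y (x∉ ∘ x∈p∪q⁺ ∘ inj₁) , x∉⁅y⁆⇒x≢y (x∉ ∘ x∈p∪q⁺ ∘ inj₂)

at-most-one-other : ∀ {n} {p : Subset n} {v} → ∣ p ∣ ≤ 2 → v ∈ p →
  ∃ λ a → ∀ w → w ∈ p → w ≡ v ⊎ w ≡ a
at-most-one-other {p = p} {v} ∣p∣≤2 v∈p with nonempty? (p - v)
... | no rest-empty = v , λ w w∈p → inj₁ (only-v w w∈p)
  where
  only-v : ∀ w → w ∈ p → w ≡ v
  only-v w w∈p with w ≟ v
  ... | yes w≡v = w≡v
  ... | no  w≢v = ⊥-elim (rest-empty (w , x∈p∧x≢y⇒x∈p-y w∈p w≢v))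
... | yes (a , a∈p-v) = a , v-or-a
  where
  v-or-a : ∀ w → w ∈ p → w ≡ v ⊎ w ≡ a
  v-or-a w w∈p with w ≟ v | w ≟ a
  ... | yes w≡v | _       = inj₁ w≡v
  ... | no  _   | yes w≡a = inj₂ w≡a
  ... | no  w≢v | no  w≢a = ⊥-elim (ℕ.<-irrefl refl (≤-trans three≤ ∣p∣≤2))
    where
    three≤ : 3 ≤ ∣ p ∣
    three≤ = size-after-removal v∈p (size-after-removal a∈p-v
      (size-after-removal (x∈p∧x≢y⇒x∈p-y (x∈p∧x≢y⇒x∈p-y w∈p w≢v) w≢a) z≤n))

walk-exits : ∀ {n} {E : Fin n → Fin n → Bool} (X : Fin n → Set) → Decidable X →
  ∀ {s t} → Walk E s t → X s → ¬ X t → ∃₂ λ p q → X p × ¬ X q × E p q ≡ true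
walk-exits X X? here               Xs ¬Xt = ⊥-elim (¬Xt Xs)
walk-exits X X? (step {w = w} e W) Xs ¬Xt with X? w
... | yes Xw = walk-exits X X? W Xw ¬Xt
... | no ¬Xw = _ , w , Xs , ¬Xw , e

CoversTriangle : {A : Set} → (A → Set) → A → A → A → Set
CoversTriangle P x y z = (P x ⊎ P y) × (P x ⊎ P z) × (P y ⊎ P z)

-- A cover of a triangle contains two of its three vertices, so two
-- disjoint covers cannot exist.
disjoint-triangle-covers : {A : Set} (P Q : A → Set) {x y z : A} →
  (∀ e → P e → ¬ Q e) → CoversTriangle P x y z → CoversTriangle Q x y z → ⊥
disjoint-triangle-covers P Q P∩Q=∅ (inj₁ Px , _ , Py∨Pz) (Qx∨Qy , Qx∨Qz , _)
  with Qx∨Qy | Qx∨Qz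
... | inj₁ Qx | _       = P∩Q=∅ _ Px Qx
... | inj₂ _  | inj₁ Qx = P∩Q=∅ _ Px Qx
... | inj₂ Qy | inj₂ Qz with Py∨Pz
...   | inj₁ Py = P∩Q=∅ _ Py Qy
...   | inj₂ Pz = P∩Q=∅ _ Pz Qz
disjoint-triangle-covers P Q P∩Q=∅ (inj₂ Py , Px∨Pz , _) (Qx∨Qy , _ , Qy∨Qz)
  with Qx∨Qy
... | inj₂ Qy = P∩Q=∅ _ Py Qy
... | inj₁ Qx with Px∨Pz
...   | inj₁ Px = P∩Q=∅ _ Px Qx
...   | inj₂ Pz with Qy∨Qz
...     | inj₁ Qy = P∩Q=∅ _ Py Qy
...     | inj₂ Qz = P∩Q=∅ _ Pz Qz

N : ∀ {n} → Graph n → Fin n → Subset n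
N G u = tabulate (adj G u)

deg : ∀ {n} → Graph n → Fin n → ℕ
deg G u = ∣ N G u ∣

adj⇒∈N : ∀ {n} (G : Graph n) {u v} → adj G u v ≡ true → v ∈ N G u
adj⇒∈N G {u} {v} uv = lookup⇒[]= v (N G u) (trans (lookup∘tabulate (adj G u) v) uv)

⟦_⟧ : Bool → ℕ
⟦ b ⟧ = if b then 1 else 0

∣tabulate∣ : ∀ {n} (f : Fin n → Bool) → ∣ tabulate f ∣ ≡ ∑[ i < n ] ⟦ f i ⟧
∣tabulate∣ {zero}  f = refl
∣tabulate∣ {suc n} f with f zero
... | true  = cong suc (∣tabulate∣ (f ∘ suc))
... | false = ∣tabulate∣ (f ∘ suc)

record TwoTrees {n} (G : Graph n) (S : Subset n) : Set where
  field
    T₀ T₁    : STree G S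
    disjoint : ∀ p q → E T₀ p q ≡ true → E T₁ p q ≢ true

two-disjoint-trees : ∀ {n} {G : Graph n} → Kappa G 3 2 →
  ∀ S → ∣ S ∣ ≡ 3 → TwoTrees G S
two-disjoint-trees (κ≥2 , _) S ∣S∣≡3 with κ≥2 S ∣S∣≡3
... | _ , ((T , disjoint) , _) , s≤s (s≤s _) = record
  { T₀ = T zero
  ; T₁ = T (suc zero)
  ; disjoint = λ p q e → not-¬ (proj₁ (disjoint zero (suc zero) (λ ())) p q e)
  }

tree-edge-at : ∀ {n} {G : Graph n} {S} (T : STree G S) {s t} →
  s ∈ S → t ∈ S → t ≢ s → ∃ λ w → E T s w ≡ true
tree-edge-at T {s} {t} s∈S t∈S t≢s
  with walk-exits (_≡ s) (_≟ s) (conn T s t (S⊆V T s s∈S) (S⊆V T t t∈S)) refl t≢s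
... | _ , w , refl , _ , e = w , e

InTree : ∀ {n} {G : Graph n} {S} → STree G S → Fin n × Fin n → Set
InTree T (p , q) = E T p q ≡ true

-- Let N(u) ⊆ {v, a} and N(v) ⊆ {u, b}.  An S-tree with
-- u, v, x ∈ S (x ∉ {u, v}) has an edge at u, an edge at v and an edge
-- leaving {u, v}; hence it contains two of the edges uv, ua, vb.
tree-covers-triangle : ∀ {n} {G : Graph n} {S} (T : STree G S) {u v a b x} →
  u ∈ S → v ∈ S → x ∈ S → x ≢ u → x ≢ v →
  (∀ w → w ∈ N G u → w ≡ v ⊎ w ≡ a) → (∀ w → w ∈ N G v → w ≡ u ⊎ w ≡ b) →
  CoversTriangle (InTree T) (u , v) (u , a) (v , b)
tree-covers-triangle {G = G} T {u} {v} {a} {b} {x} u∈S v∈S x∈S x≢u x≢v N[u]⊆v,a N[v]⊆u,b =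
  at-u , at-v , leaving-uv
  where
  in-N : ∀ {p q} → E T p q ≡ true → q ∈ N G p
  in-N e = adj⇒∈N G (E-sub T _ _ e)

  at-u : E T u v ≡ true ⊎ E T u a ≡ true
  at-u with tree-edge-at T u∈S x∈S x≢u
  ... | w , e with N[u]⊆v,a w (in-N e)
  ...   | inj₁ refl = inj₁ e
  ...   | inj₂ refl = inj₂ e

  at-v : E T u v ≡ true ⊎ E T v b ≡ true
  at-v with tree-edge-at T v∈S x∈S x≢v
  ... | w , e with N[v]⊆u,b w (in-N e)
  ...   | inj₁ refl = inj₁ (trans (E-sym T u v) e)
  ...   | inj₂ refl = inj₂ e

  leaving-uv : E T u a ≡ true ⊎ E T v b ≡ true
  leaving-uv with walk-exits (λ w → w ≡ u ⊎ w ≡ v) (λ w → (w ≟ u) ⊎-dec (w ≟ v))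
                   (conn T u x (S⊆V T u u∈S) (S⊆V T x x∈S)) (inj₁ refl) [ x≢u , x≢v ]
  ... | _ , q , inj₁ refl , q∉ , e with N[u]⊆v,a q (in-N e)
  ...   | inj₁ q≡v = ⊥-elim (q∉ (inj₂ q≡v))
  ...   | inj₂ refl = inj₁ e
  leaving-uv | _ , q , inj₂ refl , q∉ , e with N[v]⊆u,b q (in-N e)
  ...   | inj₁ q≡u = ⊥-elim (q∉ (inj₁ q≡u))
  ...   | inj₂ refl = inj₂ e

-- Two edge-disjoint S-trees use two different edges at each u ∈ S,
-- so u has degree at least 2.
two-trees⇒deg≥2 : ∀ {n} {G : Graph n} {S} → TwoTrees G S → ∀ {u y} →
  u ∈ S → y ∈ S → y ≢ u → 2 ≤ deg G u
two-trees⇒deg≥2 {G = G} record { T₀ = T₀ ; T₁ = T₁ ; disjoint = disjoint } {u} u∈S y∈S y≢u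
  with tree-edge-at T₀ u∈S y∈S y≢u | tree-edge-at T₁ u∈S y∈S y≢u
... | w₀ , e₀ | w₁ , e₁ =
  two-members (adj⇒∈N G (E-sub T₀ u w₀ e₀)) (adj⇒∈N G (E-sub T₁ u w₁ e₁)) w₁≢w₀
  where
  w₁≢w₀ : w₁ ≢ w₀
  w₁≢w₀ w₁≡w₀ = disjoint u w₀ e₀ (subst (λ w → E T₁ u w ≡ true) w₁≡w₀ e₁)

-- If N(u) ⊆ {v, a} and N(v) ⊆ {u, b} (a "thin edge" uv), no set S
-- containing u, v and a third vertex x has two edge-disjoint S-trees:
-- both would cover the triangle of edges uv, ua, vb.
two-trees⇒¬thin-edge : ∀ {n} {G : Graph n} {S} → TwoTrees G S → ∀ {u v a b x} →
  u ∈ S → v ∈ S → x ∈ S → x ≢ u → x ≢ v →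
  (∀ w → w ∈ N G u → w ≡ v ⊎ w ≡ a) → (∀ w → w ∈ N G v → w ≡ u ⊎ w ≡ b) → ⊥
two-trees⇒¬thin-edge {G = G} {S} record { T₀ = T₀ ; T₁ = T₁ ; disjoint = disjoint } {u} {v} {a} {b}
  u∈S v∈S x∈S x≢u x≢v N[u]⊆v,a N[v]⊆u,b =
  disjoint-triangle-covers (InTree T₀) (InTree T₁) (λ (p , q) → disjoint p q)
    (covers T₀) (covers T₁)
  where
  covers : (T : STree G S) → CoversTriangle (InTree T) (u , v) (u , a) (v , b)
  covers T = tree-covers-triangle T u∈S v∈S x∈S x≢u x≢v N[u]⊆v,a N[v]⊆u,b

module _ {n} (G : Graph n) (n≥3 : 3 ≤ n) (κ₃≡2 : Kappa G 3 2) where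

  min-degree : ∀ u → 2 ≤ deg G u
  min-degree u with third-vertex n≥3 u u
  ... | y , y≢u , _ with third-vertex n≥3 u y
  ... | x , x≢u , x≢y =
    two-trees⇒deg≥2 (two-disjoint-trees κ₃≡2 (triple u y x) (∣triple∣≡3 u y x y≢u x≢u x≢y))
      (first∈triple u y x) (second∈triple u y x) y≢u

  no-adjacent-degree-two : ∀ u v → adj G u v ≡ true → deg G u ≤ 2 → deg G v ≤ 2 → ⊥
  no-adjacent-degree-two u v uv du dv
    with at-most-one-other du (adj⇒∈N G uv)
       | at-most-one-other dv (adj⇒∈N G (trans (Graph.sym G v u) uv))
       | third-vertex n≥3 u v
  ... | a , N[u]⊆v,a | b , N[v]⊆u,b | x , x≢u , x≢v =
    two-trees⇒¬thin-edge
      (two-disjoint-trees κ₃≡2 (triple u v x) (∣triple∣≡3 u v x v≢u x≢u x≢v))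
      (first∈triple u v x) (second∈triple u v x) (third∈triple u v x)
      x≢u x≢v N[u]⊆v,a N[v]⊆u,b
    where
    v≢u : v ≢ u
    v≢u refl with () ← trans (sym uv) (irrefl G u)

module Discharging {n} (G : Graph n)
  (min-deg : ∀ u → 2 ≤ deg G u)
  (deg-two-independent : ∀ u v → adj G u v ≡ true → deg G u ≡ 2 → deg G v ≡ 2 → ⊥)
  where

  isTwo : Fin n → Bool
  isTwo u = deg G u ≡ᵇ 2

  -- The share of the charge 10 of the edge uv that goes to u.
  share : Fin n → Fin n → ℕ
  share u v = if isTwo u then 6 else if isTwo v then 4 else 5

  charge : Fin n → Fin n → ℕ
  charge u v = if adj G u v then share u v else 0

  isTwo⇒deg≡2 : ∀ {w} → isTwo w ≡ true → deg G w ≡ 2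
  isTwo⇒deg≡2 {w} e = ℕ.≡ᵇ⇒≡ (deg G w) 2 (subst T (sym e) _)

  -- Every edge distributes exactly 10 (a 6/6 split would need adjacent
  -- vertices of degree 2).
  edge-charge : ∀ u v → charge u v + charge v u ≡ 10 * ⟦ adj G u v ⟧
  edge-charge u v with adj G u v in uv | adj G v u in vu
  ... | false | false = refl
  ... | true  | false with () ← trans (sym uv) (trans (Graph.sym G u v) vu)
  ... | false | true  with () ← trans (sym vu) (trans (Graph.sym G v u) uv)
  ... | true  | true  with isTwo u in two-u | isTwo v in two-v
  ...   | true  | true  = ⊥-elim (deg-two-independent u v uv (isTwo⇒deg≡2 two-u) (isTwo⇒deg≡2 two-v))
  ...   | true  | false = refl
  ...   | false | true  = refl
  ...   | false | false = refl

  deg≡∑ : ∀ u → deg G u ≡ ∑[ v < n ] ⟦ adj G u v ⟧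
  deg≡∑ u = ∣tabulate∣ (adj G u)

  charge-at-two : ∀ {u} → deg G u ≡ 2 → ∀ v → charge u v ≡ 6 * ⟦ adj G u v ⟧
  charge-at-two {u} d v with adj G u v
  ... | false = refl
  ... | true rewrite d = refl

  charge-at-other : ∀ {u} → deg G u ≢ 2 → ∀ v → 4 * ⟦ adj G u v ⟧ ≤ charge u v
  charge-at-other {u} d v with adj G u v
  ... | false = z≤n
  ... | true with isTwo u in two-u
  ...   | true = ⊥-elim (d (isTwo⇒deg≡2 two-u))
  ...   | false with isTwo v
  ...     | true  = ℕ.≤-refl
  ...     | false = ℕ.n≤1+n 4

  vertex-charge : ∀ u → 12 ≤ ∑[ v < n ] charge u v
  vertex-charge u with deg G u ℕ.≟ 2
  ... | yes d = ≤-reflexive (begin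
    12                               ≡⟨ cong (6 *_) d ⟨
    6 * deg G u                      ≡⟨ cong (6 *_) (deg≡∑ u) ⟩
    6 * ∑[ v < n ] ⟦ adj G u v ⟧     ≡⟨ *-distribˡ-sum 6 (λ v → ⟦ adj G u v ⟧) ⟩
    ∑[ v < n ] (6 * ⟦ adj G u v ⟧)   ≡⟨ sum-cong-≗ (charge-at-two d) ⟨
    ∑[ v < n ] charge u v            ∎)
    where open ≡-Reasoning
  ... | no d = begin
    12                               ≤⟨ ℕ.*-monoʳ-≤ 4 (ℕ.≤∧≢⇒< (min-deg u) (d ∘ sym)) ⟩
    4 * deg G u                      ≡⟨ cong (4 *_) (deg≡∑ u) ⟩
    4 * ∑[ v < n ] ⟦ adj G u v ⟧     ≡⟨ *-distribˡ-sum 4 (λ v → ⟦ adj G u v ⟧) ⟩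
    ∑[ v < n ] (4 * ⟦ adj G u v ⟧)   ≤⟨ ∑-mono-≤ (charge-at-other d) ⟩
    ∑[ v < n ] charge u v            ∎
    where open ℕ.≤-Reasoning

  total-charge : ∑[ u < n ] ∑[ v < n ] charge u v ≡ 10 * edgeCount G
  total-charge = begin
    ∑[ u < n ] ∑[ v < n ] charge u v
      ≡⟨ ∑∑-unordered n charge no-loop ⟩
    ∑[ u < n ] ∑[ v < n ] (if u <ꟳ v then charge u v + charge v u else 0)
      ≡⟨ sum-cong-≗ (λ u → sum-cong-≗ (per-pair u)) ⟩
    ∑[ u < n ] ∑[ v < n ] (10 * ⟦ u <ꟳ v ∧ adj G u v ⟧)
      ≡⟨ sum-cong-≗ (λ u → *-distribˡ-sum 10 (λ v → ⟦ u <ꟳ v ∧ adj G u v ⟧)) ⟨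
    ∑[ u < n ] (10 * ∑[ v < n ] ⟦ u <ꟳ v ∧ adj G u v ⟧)
      ≡⟨ *-distribˡ-sum 10 (λ u → ∑[ v < n ] ⟦ u <ꟳ v ∧ adj G u v ⟧) ⟨
    10 * ∑[ u < n ] ∑[ v < n ] ⟦ u <ꟳ v ∧ adj G u v ⟧
      ≡⟨ cong (10 *_) edgeCount≡∑∑ ⟨
    10 * edgeCount G
      ∎
    where
    open ≡-Reasoning
    no-loop : ∀ u → charge u u ≡ 0
    no-loop u rewrite irrefl G u = refl
    per-pair : ∀ u v → (if u <ꟳ v then charge u v + charge v u else 0)
                       ≡ 10 * ⟦ u <ꟳ v ∧ adj G u v ⟧
    per-pair u v with u <ꟳ v
    ... | true  = edge-charge u v
    ... | false = refl
    edgeCount≡∑∑ : edgeCount G ≡ ∑[ u < n ] ∑[ v < n ] ⟦ u <ꟳ v ∧ adj G u v ⟧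
    edgeCount≡∑∑ = trans (sumᴸ-allFin n _)
      (sum-cong-≗ (λ u → sumᴸ-allFin n (λ v → ⟦ u <ꟳ v ∧ adj G u v ⟧)))

  sparse-bound : 6 * n ≤ 5 * edgeCount G
  sparse-bound = ℕ.*-cancelˡ-≤ 2 (subst₂ _≤_ (ℕ.*-assoc 2 6 n) (ℕ.*-assoc 2 5 (edgeCount G)) (begin
    12 * n                              ≡⟨ ∑-const n 12 ⟨
    ∑[ u < n ] 12                       ≤⟨ ∑-mono-≤ vertex-charge ⟩
    ∑[ u < n ] ∑[ v < n ] charge u v    ≡⟨ total-charge ⟩
    10 * edgeCount G                    ∎))
    where open ℕ.≤-Reasoning

proposition2p1 : ∀ (n : ℕ) (G : Graph n) → 3 ≤ n → Connected G →
    Kappa G 3 2 → 6 * n ≤ 5 * edgeCount G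
proposition2p1 n G n≥3 _ κ₃≡2 = Discharging.sparse-bound G
  (min-degree G n≥3 κ₃≡2)
  (λ u v uv du dv → no-adjacent-degree-two G n≥3 κ₃≡2 u v uv (≤-reflexive du) (≤-reflexive dv))
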